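{- Let $G$ be a connected graph with no subgraph isomorphic to $Y$ that has an edge-dominating cycle of length at least $4$, and suppose the maximum length $k$ of an edge-dominating cycle in $G$ equals $4$. Then either $G$ is obtained from a graph with at most six vertices by cloning leaves, or $G$ is a spiked necklace (and hence belongs to $\mathcal{B}$).
   Context: All graphs are finite and simple. $Y$ is the 7-vertex tree obtained from $K_{1,3}$ by subdividing each edge once. A cycle is edge-dominating if every edge of $G$ has an endpoint on it. Cloning a vertex $v$ means adding new vertices, pairwise nonadjacent with each other and with $v$, each with the same neighbourhood as $v$; cloning leaves means applying this to degree-1 vertices. Beads: for integers $t_1\ge0$, $t_2\ge2$, a bead is one of $K_4$, $K_{2,1,1}$, $K_{1,1,t_1}$, $K_{2,t_2}$, with primary vertices: the two singleton-part vertices of $K_{1,1,t_1}$; the two vertices of the size-two part of $K_{2,t_2}$ and of $K_{2,1,1}$; one designated vertex of $K_4$. Beads are strung together by identifying a primary vertex of one bead with a primary vertex of a different bead, each primary vertex being identified with at most one other. For such a connected graph, the bipartite auxiliary graph $A$ has a vertex per bead and per primary vertex, a bead adjacent to its primary vertices; the graph is a necklace if $A$ is a cycle (no $K_4$ beads; a necklace with exactly two beads cannot have both of the form $K_{1,1,t_1}$) and a strand if $A$ is a path. A spiked necklace is a necklace with extra pendant edges (spikes), each incident with a primary vertex lying in exactly two beads. $\mathcal{B}$ consists of $K_1$ and all spiked strands and spiked necklaces. -}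

module Defs where

open import Data.Bool using (Bool; true; false; T; if_then_else_)
open import Data.Nat using (ℕ; zero; suc; _≤_; _%_)
open import Data.Nat.DivMod using (m%n<n)
open import Data.Fin using (Fin; zero; suc; toℕ; fromℕ<)
open import Data.List using (List; map; allFin)
open import Data.Nat.ListAction using (sum)
open import Data.Product using (Σ; ∃; _×_; _,_)
open import Data.Sum using (_⊎_)
open import Data.Empty using (⊥)
open import Data.Unit using (⊤)
open import Relation.Nullary using (¬_)
open import Relation.Binary.PropositionalEquality using (_≡_; _≢_)
open import Function.Definitions using (Injective; Surjective)
open import Function.Bundles using (_↔_; Inverse; _⇔_)

record Graph : Set where
  field
    n      : ℕ
    adj    : Fin n → Fin n → Bool
    sym    : ∀ u v → adj u v ≡ adj v u
    irrefl : ∀ v → adj v v ≡ false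

open Graph public

Edge : (G : Graph) → Fin (n G) → Fin (n G) → Set
Edge G u v = T (adj G u v)

degree : (G : Graph) → Fin (n G) → ℕ
degree G w = sum (map (λ v → if adj G w v then 1 else 0) (allFin (n G)))

IsLeaf : (G : Graph) → Fin (n G) → Set
IsLeaf G w = degree G w ≡ 1

data Walk (G : Graph) : Fin (n G) → Fin (n G) → Set where
  here : ∀ {u} → Walk G u u
  step : ∀ {u w v} → Edge G u w → Walk G w v → Walk G u v

Connected : Graph → Set
Connected G = ∀ u v → Walk G u v

-- Y = K_{1,3} with each edge subdivided once.
-- Vertices: 0 centre; 1,2,3 middle; 4,5,6 leaves; edges 0-1,0-2,0-3,1-4,2-5,3-6.

HasYSubgraph : Graph → Set
HasYSubgraph G =
  Σ (Fin 7 → Fin (n G)) λ f →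
    Injective _≡_ _≡_ f ×
    Edge G (f 0f) (f 1f) × Edge G (f 0f) (f 2f) × Edge G (f 0f) (f 3f) ×
    Edge G (f 1f) (f 4f) × Edge G (f 2f) (f 5f) × Edge G (f 3f) (f 6f)
  where
  0f 1f 2f 3f 4f 5f 6f : Fin 7
  0f = zero
  1f = suc zero
  2f = suc (suc zero)
  3f = suc (suc (suc zero))
  4f = suc (suc (suc (suc zero)))
  5f = suc (suc (suc (suc (suc zero))))
  6f = suc (suc (suc (suc (suc (suc zero)))))

nextF : ∀ {k} → Fin k → Fin k
nextF {suc k} i = fromℕ< (m%n<n (suc (toℕ i)) (suc k))

record Cycle (G : Graph) (k : ℕ) : Set where
  field
    len≥3  : 3 ≤ k
    vtx    : Fin k → Fin (n G)
    inj    : Injective _≡_ _≡_ vtx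
    closed : ∀ i → Edge G (vtx i) (vtx (nextF i))

open Cycle public

EdgeDominating : (G : Graph) {k : ℕ} → Cycle G k → Set
EdgeDominating G C =
  ∀ u v → Edge G u v → ∃ λ i → vtx C i ≡ u ⊎ vtx C i ≡ v

HasEDCycle : Graph → ℕ → Set
HasEDCycle G k = Σ (Cycle G k) (EdgeDominating G)

-- Cloning leaves: G is obtained from H by cloning (some) leaves of H iff
-- there is a surjection p : V(G) → V(H) with G the pullback of H along p
-- (uv ∈ E(G) ⇔ p(u)p(v) ∈ E(H)), and every fibre of size ≥ 2 lies over a
-- leaf of H (the extra elements of the fibre being the clones).

ObtainedByCloningLeaves : (G H : Graph) → Set
ObtainedByCloningLeaves G H =
  Σ (Fin (n G) → Fin (n H)) λ p →
    Surjective _≡_ _≡_ p ×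
    (∀ u v → adj G u v ≡ adj H (p u) (p v)) ×
    (∀ u v → u ≢ v → p u ≡ p v → IsLeaf H (p u))

FromSmallByCloningLeaves : ℕ → Graph → Set
FromSmallByCloningLeaves m G =
  Σ Graph λ H → n H ≤ m × ObtainedByCloningLeaves G H

-- Beads usable in a necklace (K4 is not allowed in necklaces).
-- Every such bead has two primary vertices a, b and some inner vertices,
-- each inner vertex adjacent to both a and b.

data Bead : Set where
  K211 : Bead                          -- K_{2,1,1}: a,b the size-two part
  K11  : (t : ℕ) → Bead                -- K_{1,1,t}, t ≥ 0: a,b the singleton parts
  K2   : (t : ℕ) → 2 ≤ t → Bead        -- K_{2,t}, t ≥ 2: a,b the size-two part

innerSize : Bead → ℕ
innerSize K211     = 2
innerSize (K11 t)  = t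
innerSize (K2 t _) = t

primEdge : Bead → Bool
primEdge K211     = false
primEdge (K11 _)  = true
primEdge (K2 _ _) = false

IsK211 : Bead → Set
IsK211 K211 = ⊤
IsK211 _    = ⊥

IsK11 : Bead → Set
IsK11 (K11 _) = ⊤
IsK11 _       = ⊥

-- Spiked necklace with r beads B_0 … B_{r-1} (r ≥ 2) and r primary vertices
-- P_0 … P_{r-1}, bead B_i having primary vertices P_i and P_{i+1 mod r}
-- (so the auxiliary graph A is the cycle B_0 P_1 B_1 P_2 … B_{r-1} P_0),
-- with sp i pendant edges (spikes) at P_i.
module Necklace (r : ℕ) (bt : Fin r → Bead) (sp : Fin r → ℕ) where

  data NV : Set where
    prim  : Fin r → NV
    inner : (b : Fin r) → Fin (innerSize (bt b)) → NV
    spike : (i : Fin r) → Fin (sp i) → NV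

  NAdj : NV → NV → Set
  NAdj (prim i) (prim j) =
    Σ (Fin r) λ b → T (primEdge (bt b)) ×
      ((b ≡ i × nextF b ≡ j) ⊎ (b ≡ j × nextF b ≡ i))
  NAdj (prim i) (inner b x) = i ≡ b ⊎ i ≡ nextF b
  NAdj (inner b x) (prim i) = i ≡ b ⊎ i ≡ nextF b
  NAdj (inner b x) (inner b' y) = IsK211 (bt b) × b ≡ b' × toℕ x ≢ toℕ y
  NAdj (prim i) (spike j s) = i ≡ j
  NAdj (spike j s) (prim i) = i ≡ j
  NAdj _ _ = ⊥

IsSpikedNecklace : Graph → Set
IsSpikedNecklace G =
  Σ ℕ λ m →
  let r = suc (suc m) in
  Σ (Fin r → Bead) λ bt →
  Σ (Fin r → ℕ) λ sp →
    -- a necklace with exactly two beads cannot have both of the form K_{1,1,t}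
    (m ≡ 0 → ¬ (IsK11 (bt zero) × IsK11 (bt (suc zero)))) ×
    Σ (Fin (n G) ↔ Necklace.NV r bt sp) λ f →
      ∀ u v → Edge G u v ⇔ Necklace.NAdj r bt sp (Inverse.to f u) (Inverse.to f v)

-- Let a b c d be an edge-dominating 4-cycle. A vertex off it has all its neighbours among the corners,
-- and at least one by connectivity. It cannot see two consecutive corners, since the cycle would then
-- extend to an edge-dominating 5-cycle; so it is a pendant at one corner or sees exactly two opposite
-- corners, and such outside vertices are pairwise non-adjacent. Thus G is determined by the diagonals
-- of the square and by which of these six kinds of outside vertices occur (its "profiles").
-- Further long edge-dominating cycles and copies of Y leave few configurations: with both diagonals,
-- G is K₄ with pendants at no more than two corners, cloned; with one diagonal b d and pendants at a and
-- at c, a diamond with cloned pendants; otherwise a spiked necklace with beads a–b, b–d, d–a, or with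
-- the four edges of the square as beads. Each identification is verified by evaluating both
-- adjacencies on the finitely many profiles.

module Submission where

open import Defs
open import Data.Bool using (Bool; true; false; T; not; _∧_; _∨_)
open import Data.Bool.Properties using (T-∧; T-∨; T-≡; T-not-≡; T-irrelevant)
open import Data.Nat using (ℕ; zero; suc; _+_; _≤_; z≤n; s≤s; _≡ᵇ_)
open import Data.Nat.Properties using (≡ᵇ⇒≡; ≤-refl; ≤-trans; n≤1+n; <⇒≱)
open import Data.Fin using (Fin; zero; suc; toℕ; cast)
open import Data.Fin.Patterns using (0F; 1F; 2F; 3F; 4F; 5F)
open import Data.Fin.Properties using (_≟_; any?; suc-injective; cast-involutive)
open import Data.List using (List; []; _∷_)
open import Data.Vec using (Vec; []; _∷_; lookup)
open import Data.Vec.Relation.Unary.All using ([]; _∷_)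
open import Data.Vec.Relation.Unary.AllPairs using ([]; _∷_)
open import Data.Vec.Relation.Unary.Unique.Propositional using (Unique)
open import Data.Vec.Relation.Unary.Unique.Propositional.Properties using (lookup-injective)
open import Data.Product using (∃; _×_; _,_; proj₁; proj₂)
open import Data.Sum using (_⊎_; inj₁; inj₂; [_,_])
import Data.Sum as Sum
open import Data.Empty using (⊥; ⊥-elim)
open import Data.Unit using (tt)
open import Function.Bundles using (Equivalence; _↔_; _⇔_; mk↔ₛ′; mk⇔)
open import Relation.Nullary using (Dec; yes; no; ¬_)
open import Relation.Nullary.Decidable using (⌊_⌋; toWitness; fromWitness; T?; ¬?; _×-dec_; _⊎-dec_)
import Relation.Binary.PropositionalEquality as ≡
open ≡ using (_≡_; _≢_; ≢-sym; refl; cong; cong₂; subst; trans)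
open import Function using (_∘_; id; case_of_)

count : ∀ {k} → (Fin k → Bool) → ℕ
count {zero}  P = 0
count {suc k} P with P zero
... | true  = suc (count (λ i → P (suc i)))
... | false = count (λ i → P (suc i))

rank : ∀ {k} (P : Fin k → Bool) (u : Fin k) → T (P u) → Fin (count P)
rank {suc k} P zero    p with P zero
... | true  = zero
rank {suc k} P (suc u) p with P zero
... | true  = suc (rank (λ i → P (suc i)) u p)
... | false = rank (λ i → P (suc i)) u p

select : ∀ {k} (P : Fin k → Bool) → Fin (count P) → Fin k
select {suc k} P x with P zero
select {suc k} P zero    | true  = zero
select {suc k} P (suc y) | true  = suc (select (λ i → P (suc i)) y)
select {suc k} P x       | false = suc (select (λ i → P (suc i)) x)

select-satisfies : ∀ {k} (P : Fin k → Bool) x → T (P (select P x))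
select-satisfies {suc k} P x with P zero in eq
select-satisfies {suc k} P zero    | true  = subst T (≡.sym eq) tt
select-satisfies {suc k} P (suc y) | true  = select-satisfies (λ i → P (suc i)) y
select-satisfies {suc k} P x       | false = select-satisfies (λ i → P (suc i)) x

select-rank : ∀ {k} (P : Fin k → Bool) u p → select P (rank P u p) ≡ u
select-rank {suc k} P zero    p with P zero
... | true  = refl
select-rank {suc k} P (suc u) p with P zero
... | true  = cong suc (select-rank (λ i → P (suc i)) u p)
... | false = cong suc (select-rank (λ i → P (suc i)) u p)

select-injective : ∀ {k} (P : Fin k → Bool) x y → select P x ≡ select P y → x ≡ y
select-injective {suc k} P x y e with P zero
select-injective {suc k} P zero    zero    e  | true = refl
select-injective {suc k} P (suc x) (suc y) e  | true =
  cong suc (select-injective (λ i → P (suc i)) x y (suc-injective e))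
select-injective {suc k} P x y e | false = select-injective (λ i → P (suc i)) x y (suc-injective e)

rank-select : ∀ {k} (P : Fin k → Bool) x p → rank P (select P x) p ≡ x
rank-select P x p = select-injective P _ _ (select-rank P (select P x) p)

count-none : ∀ {k} (P : Fin k → Bool) → (∀ u → P u ≡ false) → count P ≡ 0
count-none {zero}  P none = refl
count-none {suc k} P none with P zero | none zero
... | false | _ = count-none (λ i → P (suc i)) (λ i → none (suc i))

count-two : ∀ {k} (P : Fin k → Bool) u v → T (P u) → T (P v) → u ≢ v → 2 ≤ count P
count-two P u v p q u≢v = two-distinct (rank P u p) (rank P v q) rank-distinct
  where
  two-distinct : ∀ {m} (x y : Fin m) → x ≢ y → 2 ≤ m
  two-distinct {suc zero}    zero zero x≢y = ⊥-elim (x≢y refl)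
  two-distinct {suc (suc m)} _    _    _   = s≤s (s≤s z≤n)
  rank-distinct : rank P u p ≢ rank P v q
  rank-distinct e = u≢v (trans (≡.sym (select-rank P u p)) (trans (cong (select P) e) (select-rank P v q)))

infixr 4 _⇒ᵇ_
infix 7 _==ᵇ_ _=ᶠ_

_⇒ᵇ_ : Bool → Bool → Bool
p ⇒ᵇ q = not p ∨ q

⇒ᵇ-elim : ∀ {p q} → T (p ⇒ᵇ q) → T p → T q
⇒ᵇ-elim {true} {true} _ _ = tt

¬T⇒≡false : ∀ {p} → ¬ T p → p ≡ false
¬T⇒≡false {true}  ¬p = ⊥-elim (¬p tt)
¬T⇒≡false {false} _  = refl

_==ᵇ_ : Bool → Bool → Bool
true  ==ᵇ true  = true
false ==ᵇ false = true
_     ==ᵇ _     = false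

==ᵇ-sound : ∀ {p q} → T (p ==ᵇ q) → p ≡ q
==ᵇ-sound {true}  {true}  _ = refl
==ᵇ-sound {false} {false} _ = refl

_=ᶠ_ : ∀ {k} → Fin k → Fin k → Bool
i =ᶠ j = ⌊ i ≟ j ⌋

=ᶠ-sound : ∀ {k} {i j : Fin k} → T (i =ᶠ j) → i ≡ j
=ᶠ-sound {i = i} {j} = toWitness {a? = i ≟ j}

=ᶠ-complete : ∀ {k} {i j : Fin k} → i ≡ j → T (i =ᶠ j)
=ᶠ-complete {i = i} {j} = fromWitness {a? = i ≟ j}

≡⊎≡⇔=ᶠ∨=ᶠ : ∀ {k} {i b c : Fin k} → (i ≡ b ⊎ i ≡ c) ⇔ T (i =ᶠ b ∨ i =ᶠ c)
≡⊎≡⇔=ᶠ∨=ᶠ {i = i} {b} {c} = mk⇔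
  (λ p → Equivalence.from (T-∨ {i =ᶠ b}) (Sum.map =ᶠ-complete =ᶠ-complete p))
  (λ t → Sum.map =ᶠ-sound =ᶠ-sound (Equivalence.to (T-∨ {i =ᶠ b}) t))

≡×≡⇔=ᶠ∧=ᶠ : ∀ {k} {a b c d : Fin k} → (a ≡ b × c ≡ d) ⇔ T (a =ᶠ b ∧ c =ᶠ d)
≡×≡⇔=ᶠ∧=ᶠ {a = a} {b} = mk⇔
  (λ (p , q) → Equivalence.from (T-∧ {a =ᶠ b}) (=ᶠ-complete p , =ᶠ-complete q))
  (λ t → let (p , q) = Equivalence.to (T-∧ {a =ᶠ b}) t in =ᶠ-sound p , =ᶠ-sound q)

everyFin : ∀ {k} → (Fin k → Bool) → Bool
everyFin {zero}  f = true
everyFin {suc k} f = f zero ∧ everyFin (λ i → f (suc i))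

everyFin-sound : ∀ {k} (f : Fin k → Bool) → T (everyFin f) → ∀ i → T (f i)
everyFin-sound f t zero    = proj₁ (Equivalence.to T-∧ t)
everyFin-sound f t (suc i) = everyFin-sound (λ i → f (suc i)) (proj₂ (Equivalence.to (T-∧ {f zero}) t)) i

anyFin : ∀ {k} → (Fin k → Bool) → Bool
anyFin {zero}  f = false
anyFin {suc k} f = f zero ∨ anyFin (λ i → f (suc i))

anyFin-sound : ∀ {k} (f : Fin k → Bool) → T (anyFin f) → ∃ λ i → T (f i)
anyFin-sound {suc k} f t with Equivalence.to T-∨ t
... | inj₁ p = zero , p
... | inj₂ p = let (i , q) = anyFin-sound (λ i → f (suc i)) p in suc i , q

anyFin-complete : ∀ {k} (f : Fin k → Bool) i → T (f i) → T (anyFin f)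
anyFin-complete f zero    p = Equivalence.from T-∨ (inj₁ p)
anyFin-complete f (suc i) p = Equivalence.from T-∨ (inj₂ (anyFin-complete (λ i → f (suc i)) i p))

everyBool : (Bool → Bool) → Bool
everyBool f = f true ∧ f false

everyBool-sound : ∀ f → T (everyBool f) → ∀ x → T (f x)
everyBool-sound f t true  = proj₁ (Equivalence.to T-∧ t)
everyBool-sound f t false = proj₂ (Equivalence.to (T-∧ {f true}) t)

graphFromTable : (m : ℕ) (f : Fin m → Fin m → Bool) →
  T (everyFin λ u → everyFin λ v → f u v ==ᵇ f v u) → T (everyFin λ u → not (f u u)) → Graph
graphFromTable m f symmetric irreflexive = record
  { n      = m
  ; adj    = f
  ; sym    = λ u v → ==ᵇ-sound (everyFin-sound _ (everyFin-sound _ symmetric u) v)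
  ; irrefl = λ u → Equivalence.to T-not-≡ (everyFin-sound _ irreflexive u)
  }

edgeIn : ∀ {m} → List (ℕ × ℕ) → Fin m → Fin m → Bool
edgeIn []             u v = false
edgeIn ((p , q) ∷ es) u v =
  ((p ≡ᵇ toℕ u) ∧ (q ≡ᵇ toℕ v)) ∨ ((p ≡ᵇ toℕ v) ∧ (q ≡ᵇ toℕ u)) ∨ edgeIn es u v

data Role (r : ℕ) : Set where
  primary inner spike : Fin r → Role r

sameRole : ∀ {r} → Role r → Role r → Bool
sameRole (primary i) (primary j) = i =ᶠ j
sameRole (inner i)   (inner j)   = i =ᶠ j
sameRole (spike i)   (spike j)   = i =ᶠ j
sameRole _           _           = false

sameRole-sound : ∀ {r} (x y : Role r) → T (sameRole x y) → x ≡ y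
sameRole-sound (primary i) (primary j) t = cong primary (=ᶠ-sound t)
sameRole-sound (inner i)   (inner j)   t = cong inner (=ᶠ-sound t)
sameRole-sound (spike i)   (spike j)   t = cong spike (=ᶠ-sound t)

sameRole-refl : ∀ {r} (x : Role r) → T (sameRole x x)
sameRole-refl (primary i) = =ᶠ-complete refl
sameRole-refl (inner i)   = =ᶠ-complete refl
sameRole-refl (spike i)   = =ᶠ-complete refl

-- Adjacency of a spiked necklace without K_{2,1,1} beads, read off the roles of the endpoints;
-- bead b joins the primary vertices b and nextF b, directly iff hasEdge b.
roleAdj : ∀ {r} → (Fin r → Bool) → Role r → Role r → Bool
roleAdj hasEdge (primary i) (primary j) =
  anyFin λ b → hasEdge b ∧ ((b =ᶠ i ∧ nextF b =ᶠ j) ∨ (b =ᶠ j ∧ nextF b =ᶠ i))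
roleAdj hasEdge (primary i) (inner b)   = i =ᶠ b ∨ i =ᶠ nextF b
roleAdj hasEdge (inner b)   (primary i) = i =ᶠ b ∨ i =ᶠ nextF b
roleAdj hasEdge (primary i) (spike j)   = i =ᶠ j
roleAdj hasEdge (spike j)   (primary i) = i =ᶠ j
roleAdj hasEdge _           _           = false

module SpikedNecklaceFromRoles
  (G : Graph) (m : ℕ) (bt : Fin (2 + m) → Bead) (hasEdge : Fin (2 + m) → Bool)
  (primEdge≡hasEdge : ∀ b → primEdge (bt b) ≡ hasEdge b) (¬K211 : ∀ b → ¬ IsK211 (bt b))
  (¬twoK11 : m ≡ 0 → ¬ (IsK11 (bt zero) × IsK11 (bt (suc zero))))
  (role : Fin (n G) → Role (2 + m)) (primaryVertex : Fin (2 + m) → Fin (n G))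
  (role-primaryVertex : ∀ i → role (primaryVertex i) ≡ primary i)
  (role≡primary⇒ : ∀ u i → role u ≡ primary i → u ≡ primaryVertex i)
  (count-inner : ∀ b → count (λ u → sameRole (role u) (inner b)) ≡ innerSize (bt b))
  (adj≡roleAdj : ∀ u v → adj G u v ≡ roleAdj hasEdge (role u) (role v)) where

  private
    r : ℕ
    r = 2 + m

    V : Set
    V = Fin (n G)

    Inner Spike : Fin r → V → Bool
    Inner b u = sameRole (role u) (inner b)
    Spike i u = sameRole (role u) (spike i)

  spikes : Fin r → ℕ
  spikes i = count (Spike i)

  open Necklace r bt spikes

  roleOf : NV → Role r
  roleOf (prim i)    = primary i
  roleOf (inner b _) = inner b
  roleOf (spike i _) = spike i

  private
    hasRole : ∀ u x → role u ≡ x → T (sameRole (role u) x)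
    hasRole u x e = subst (λ y → T (sameRole y x)) (≡.sym e) (sameRole-refl x)

    toNV : (u : V) (x : Role r) → role u ≡ x → NV
    toNV u (primary i) e = prim i
    toNV u (inner b)   e = inner b (cast (count-inner b) (rank (Inner b) u (hasRole u (inner b) e)))
    toNV u (spike i)   e = spike i (rank (Spike i) u (hasRole u (spike i) e))

    to : V → NV
    to u = toNV u (role u) refl

    from : NV → V
    from (prim i)    = primaryVertex i
    from (inner b x) = select (Inner b) (cast (≡.sym (count-inner b)) x)
    from (spike i x) = select (Spike i) x

    from-toNV : ∀ u x e → from (toNV u x e) ≡ u
    from-toNV u (primary i) e = ≡.sym (role≡primary⇒ u i e)
    from-toNV u (inner b)   e =
      trans (cong (select (Inner b)) (cast-involutive _ (count-inner b) _)) (select-rank (Inner b) u _)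
    from-toNV u (spike i)   e = select-rank (Spike i) u _

    roleOf-toNV : ∀ u x e → roleOf (toNV u x e) ≡ x
    roleOf-toNV u (primary i) e = refl
    roleOf-toNV u (inner b)   e = refl
    roleOf-toNV u (spike i)   e = refl

    to-selectInner : ∀ b x →
      to (select (Inner b) x) ≡ inner b (cast (count-inner b) (rank (Inner b) _ (select-satisfies (Inner b) x)))
    to-selectInner b x = go (role u) refl (sameRole-sound (role u) (inner b) (select-satisfies (Inner b) x))
      where
      u = select (Inner b) x
      go : ∀ y (e : role u ≡ y) → y ≡ inner b →
           toNV u y e ≡ inner b (cast (count-inner b) (rank (Inner b) u (select-satisfies (Inner b) x)))
      go _ e refl = cong (λ p → inner b (cast (count-inner b) (rank (Inner b) u p))) (T-irrelevant _ _)

    to-selectSpike : ∀ i x → to (select (Spike i) x) ≡ spike i (rank (Spike i) _ (select-satisfies (Spike i) x))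
    to-selectSpike i x = go (role u) refl (sameRole-sound (role u) (spike i) (select-satisfies (Spike i) x))
      where
      u = select (Spike i) x
      go : ∀ y (e : role u ≡ y) → y ≡ spike i → toNV u y e ≡ spike i (rank (Spike i) u (select-satisfies (Spike i) x))
      go _ e refl = cong (λ p → spike i (rank (Spike i) u p)) (T-irrelevant _ _)

    to-primaryVertex : ∀ i → to (primaryVertex i) ≡ prim i
    to-primaryVertex i = go (role (primaryVertex i)) refl (role-primaryVertex i)
      where
      go : ∀ y (e : role (primaryVertex i) ≡ y) → y ≡ primary i → toNV (primaryVertex i) y e ≡ prim i
      go _ e refl = refl

    to-from : ∀ y → to (from y) ≡ y
    to-from (prim i)    = to-primaryVertex i
    to-from (inner b x) = trans (to-selectInner b _)
      (cong (inner b) (trans (cong (cast (count-inner b)) (rank-select (Inner b) _ _))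
                             (cast-involutive (count-inner b) (≡.sym (count-inner b)) x)))
    to-from (spike i x) = trans (to-selectSpike i x) (cong (spike i) (rank-select (Spike i) x _))

    roleOf-to : ∀ u → roleOf (to u) ≡ role u
    roleOf-to u = roleOf-toNV u (role u) refl

  vertices↔NV : V ↔ NV
  vertices↔NV = mk↔ₛ′ to from to-from (λ u → from-toNV u (role u) refl)

  NAdj⇔roleAdj : ∀ y z → NAdj y z ⇔ T (roleAdj hasEdge (roleOf y) (roleOf z))
  NAdj⇔roleAdj (prim i)    (prim j)    = mk⇔ fw bw
    where
    bead? : Fin r → Bool
    bead? b = hasEdge b ∧ ((b =ᶠ i ∧ nextF b =ᶠ j) ∨ (b =ᶠ j ∧ nextF b =ᶠ i))
    fw : NAdj (prim i) (prim j) → T (roleAdj hasEdge (primary i) (primary j))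
    ends⇔ : ∀ b → ((b ≡ i × nextF b ≡ j) ⊎ (b ≡ j × nextF b ≡ i)) ⇔
                   T ((b =ᶠ i ∧ nextF b =ᶠ j) ∨ (b =ᶠ j ∧ nextF b =ᶠ i))
    ends⇔ b = mk⇔
      (λ p → Equivalence.from T-∨ (Sum.map (Equivalence.to ≡×≡⇔=ᶠ∧=ᶠ) (Equivalence.to ≡×≡⇔=ᶠ∧=ᶠ) p))
      (λ t → Sum.map (Equivalence.from ≡×≡⇔=ᶠ∧=ᶠ) (Equivalence.from ≡×≡⇔=ᶠ∧=ᶠ) (Equivalence.to T-∨ t))
    fw (b , e , ends) = anyFin-complete bead? b
      (Equivalence.from T-∧ (subst T (primEdge≡hasEdge b) e , Equivalence.to (ends⇔ b) ends))
    bw : T (roleAdj hasEdge (primary i) (primary j)) → NAdj (prim i) (prim j)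
    bw t with anyFin-sound bead? t
    ... | b , q with Equivalence.to (T-∧ {hasEdge b}) q
    ... | e , ends = b , subst T (≡.sym (primEdge≡hasEdge b)) e , Equivalence.from (ends⇔ b) ends
  NAdj⇔roleAdj (prim i)    (inner b x)  = ≡⊎≡⇔=ᶠ∨=ᶠ
  NAdj⇔roleAdj (inner b x) (prim i)     = ≡⊎≡⇔=ᶠ∨=ᶠ
  NAdj⇔roleAdj (inner b x) (inner c y)  = mk⇔ (λ (k211 , _) → ⊥-elim (¬K211 b k211)) λ ()
  NAdj⇔roleAdj (prim i)    (spike j x)  = mk⇔ =ᶠ-complete =ᶠ-sound
  NAdj⇔roleAdj (spike j x) (prim i)     = mk⇔ =ᶠ-complete =ᶠ-sound
  NAdj⇔roleAdj (inner b x) (spike j y)  = mk⇔ (λ ()) (λ ())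
  NAdj⇔roleAdj (spike j x) (inner b y)  = mk⇔ (λ ()) (λ ())
  NAdj⇔roleAdj (spike j x) (spike i y)  = mk⇔ (λ ()) (λ ())

  edges : ∀ u v → Edge G u v ⇔ NAdj (to u) (to v)
  edges u v = mk⇔
    (λ e → Equivalence.from (NAdj⇔roleAdj (to u) (to v)) (subst T (adj≡roleAdj' u v) e))
    (λ a → subst T (≡.sym (adj≡roleAdj' u v)) (Equivalence.to (NAdj⇔roleAdj (to u) (to v)) a))
    where
    adj≡roleAdj' : ∀ u v → adj G u v ≡ roleAdj hasEdge (roleOf (to u)) (roleOf (to v))
    adj≡roleAdj' u v = trans (adj≡roleAdj u v) (≡.sym (cong₂ (roleAdj hasEdge) (roleOf-to u) (roleOf-to v)))

  isSpikedNecklace : IsSpikedNecklace G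
  isSpikedNecklace = m , bt , spikes , ¬twoK11 , vertices↔NV , edges

pattern isA = inj₁ refl
pattern isB = inj₂ (inj₁ refl)
pattern isC = inj₂ (inj₂ (inj₁ refl))
pattern isD = inj₂ (inj₂ (inj₂ refl))

-- With respect to an edge-dominating square a b c d, a vertex is either a corner, or an outside vertex
-- recorded by its adjacencies to a, b, c, d.
data Profile : Set where
  corner  : Fin 4 → Profile
  outside : Bool → Bool → Bool → Bool → Profile

everyProfile : (Profile → Bool) → Bool
everyProfile f = everyFin (λ i → f (corner i)) ∧
  everyBool λ x → everyBool λ y → everyBool λ z → everyBool λ w → f (outside x y z w)

everyProfile-sound : ∀ f → T (everyProfile f) → ∀ x → T (f x)
everyProfile-sound f t (corner i) =
  everyFin-sound (λ i → f (corner i)) (proj₁ (Equivalence.to (T-∧ {everyFin λ i → f (corner i)}) t)) i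
everyProfile-sound f t (outside x y z w) =
  everyBool-sound (λ w → f (outside x y z w))
    (everyBool-sound (λ z → everyBool λ w → f (outside x y z w))
      (everyBool-sound (λ y → everyBool λ z → everyBool λ w → f (outside x y z w))
        (everyBool-sound (λ x → everyBool λ y → everyBool λ z → everyBool λ w → f (outside x y z w))
          (proj₂ (Equivalence.to (T-∧ {everyFin λ i → f (corner i)}) t)) x) y) z) w

everyProfile² : (Profile → Profile → Bool) → Bool
everyProfile² f = everyProfile λ x → everyProfile (f x)

everyProfile²-sound : ∀ f → T (everyProfile² f) → ∀ x y → T (f x y)
everyProfile²-sound f t x = everyProfile-sound (f x) (everyProfile-sound (λ x → everyProfile (f x)) t x)

adjToCorner : Fin 4 → Bool → Bool → Bool → Bool → Bool
adjToCorner 0F x y z w = x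
adjToCorner 1F x y z w = y
adjToCorner 2F x y z w = z
adjToCorner 3F x y z w = w

cornerAdj : (ac bd : Bool) → Fin 4 → Fin 4 → Bool
cornerAdj ac bd 0F 2F = ac
cornerAdj ac bd 2F 0F = ac
cornerAdj ac bd 1F 3F = bd
cornerAdj ac bd 3F 1F = bd
cornerAdj ac bd i  j  = not (i =ᶠ j)

squareAdj : (ac bd : Bool) → Profile → Profile → Bool
squareAdj ac bd (corner i)        (corner j)        = cornerAdj ac bd i j
squareAdj ac bd (corner i)        (outside x y z w) = adjToCorner i x y z w
squareAdj ac bd (outside x y z w) (corner j)        = adjToCorner j x y z w
squareAdj ac bd (outside _ _ _ _) (outside _ _ _ _) = false

data OutsideShape : Bool → Bool → Bool → Bool → Set where
  pendantA : OutsideShape true false false false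
  pendantB : OutsideShape false true false false
  pendantC : OutsideShape false false true false
  pendantD : OutsideShape false false false true
  oppositeAC : OutsideShape true false true false
  oppositeBD : OutsideShape false true false true

outsideShape : ∀ x y z w → (T x → T y → ⊥) → (T y → T z → ⊥) → (T z → T w → ⊥) → (T w → T x → ⊥) →
               T x ⊎ T y ⊎ T z ⊎ T w → OutsideShape x y z w
outsideShape true  true  _     _     xy _  _  _  _ = ⊥-elim (xy _ _)
outsideShape _     true  true  _     _  yz _  _  _ = ⊥-elim (yz _ _)
outsideShape _     _     true  true  _  _  zw _  _ = ⊥-elim (zw _ _)
outsideShape true  _     _     true  _  _  _  wx _ = ⊥-elim (wx _ _)
outsideShape true  false false false _  _  _  _  _ = pendantA
outsideShape false true  false false _  _  _  _  _ = pendantB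
outsideShape false false true  false _  _  _  _  _ = pendantC
outsideShape false false false true  _  _  _  _  _ = pendantD
outsideShape true  false true  false _  _  _  _  _ = oppositeAC
outsideShape false true  false true  _  _  _  _  _ = oppositeBD
outsideShape false false false false _  _  _  _  (inj₁ ())
outsideShape false false false false _  _  _  _  (inj₂ (inj₁ ()))
outsideShape false false false false _  _  _  _  (inj₂ (inj₂ (inj₁ ())))
outsideShape false false false false _  _  _  _  (inj₂ (inj₂ (inj₂ ())))

-- Profiles that can occur when the six outside shapes are permitted as flagged; profiles that
-- cannot occur are sent anywhere by the maps below.
allowed : (pA pB pC pD pAC pBD : Bool) → Profile → Bool
allowed pA pB pC pD pAC pBD (corner _)                      = true
allowed pA pB pC pD pAC pBD (outside true  false false false) = pA
allowed pA pB pC pD pAC pBD (outside false true  false false) = pB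
allowed pA pB pC pD pAC pBD (outside false false true  false) = pC
allowed pA pB pC pD pAC pBD (outside false false false true)  = pD
allowed pA pB pC pD pAC pBD (outside true  false true  false) = pAC
allowed pA pB pC pD pAC pBD (outside false true  false true)  = pBD
allowed pA pB pC pD pAC pBD _                               = false

pendantsTo : ∀ {k} (la lb lc ld : Fin (4 + k)) → Profile → Fin (4 + k)
pendantsTo la lb lc ld (corner 0F) = 0F
pendantsTo la lb lc ld (corner 1F) = 1F
pendantsTo la lb lc ld (corner 2F) = 2F
pendantsTo la lb lc ld (corner 3F) = 3F
pendantsTo la lb lc ld (outside true  false false false) = la
pendantsTo la lb lc ld (outside false true  false false) = lb
pendantsTo la lb lc ld (outside false false true  false) = lc
pendantsTo la lb lc ld (outside false false false true)  = ld
pendantsTo la lb lc ld _ = 0F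

sameCorner : Profile → Profile → Bool
sameCorner (corner i) (corner j) = i =ᶠ j
sameCorner _          _          = false

isLeafᵇ : (H : Graph) → Fin (n H) → Bool
isLeafᵇ H h = degree H h ≡ᵇ 1

allowed-shape : ∀ {pA pB pC pD pAC pBD x y z w} → OutsideShape x y z w →
  (T x → T pA) → (T y → T pB) → (T z → T pC) → (T w → T pD) → (T x → T z → T pAC) → (T y → T w → T pBD) →
  T (allowed pA pB pC pD pAC pBD (outside x y z w))
allowed-shape pendantA   hA hB hC hD hAC hBD = hA tt
allowed-shape pendantB   hA hB hC hD hAC hBD = hB tt
allowed-shape pendantC   hA hB hC hD hAC hBD = hC tt
allowed-shape pendantD   hA hB hC hD hAC hBD = hD tt
allowed-shape oppositeAC hA hB hC hD hAC hBD = hAC tt tt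
allowed-shape oppositeBD hA hB hC hD hAC hBD = hBD tt tt

outsideAdjToCorner : Fin 4 → Profile → Bool
outsideAdjToCorner i (corner _)        = false
outsideAdjToCorner i (outside x y z w) = adjToCorner i x y z w

sameCorner-corner : ∀ x j → T (sameCorner x (corner j)) → x ≡ corner j
sameCorner-corner (corner i) j t = cong corner (=ᶠ-sound t)

shape-BD : ∀ {x y z w} → OutsideShape x y z w → T y → T w → outside x y z w ≡ outside false true false true
shape-BD oppositeBD _ _ = refl

beadOn : (primEdge? : Bool) (t : ℕ) → (primEdge? ≡ false → 2 ≤ t) → Bead
beadOn true  t _   = K11 t
beadOn false t 2≤t = K2 t (2≤t refl)

primEdge-beadOn : ∀ e t 2≤t → primEdge (beadOn e t 2≤t) ≡ e
primEdge-beadOn true  t _ = refl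
primEdge-beadOn false t _ = refl

innerSize-beadOn : ∀ e t 2≤t → innerSize (beadOn e t 2≤t) ≡ t
innerSize-beadOn true  t _ = refl
innerSize-beadOn false t _ = refl

¬K211-beadOn : ∀ e t 2≤t → ¬ IsK211 (beadOn e t 2≤t)
¬K211-beadOn true  t _ ()
¬K211-beadOn false t _ ()

-- Necklace with beads a–b, b–d (inner vertices c and the common neighbours of b and d) and d–a.
roles₃ : Profile → Role 3
roles₃ (corner 0F) = primary 0F
roles₃ (corner 1F) = primary 1F
roles₃ (corner 2F) = inner 1F
roles₃ (corner 3F) = primary 2F
roles₃ (outside true  false false false) = spike 0F
roles₃ (outside false true  false false) = spike 1F
roles₃ (outside false false false true)  = spike 2F
roles₃ (outside false true  false true)  = inner 1F
roles₃ _ = spike 0F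

primaryCorner₃ : Fin 3 → Fin 4
primaryCorner₃ 0F = 0F
primaryCorner₃ 1F = 1F
primaryCorner₃ 2F = 3F

hasEdge₃ : Bool → Fin 3 → Bool
hasEdge₃ bd 1F = bd
hasEdge₃ bd _  = true

roles₄ : Profile → Role 4
roles₄ (corner i) = primary i
roles₄ (outside true  false false false) = spike 0F
roles₄ (outside false true  false false) = spike 1F
roles₄ (outside false false true  false) = spike 2F
roles₄ (outside false false false true)  = spike 3F
roles₄ _ = spike 0F

K₄-edges : List (ℕ × ℕ)
K₄-edges = (0 , 1) ∷ (0 , 2) ∷ (0 , 3) ∷ (1 , 2) ∷ (1 , 3) ∷ (2 , 3) ∷ []

K₄ K₄+pendant₀ K₄+pendant₁ K₄+pendants₀₁ diamond+pendants₀₂ : Graph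
K₄                 = graphFromTable 4 (edgeIn K₄-edges) tt tt
K₄+pendant₀        = graphFromTable 5 (edgeIn ((0 , 4) ∷ K₄-edges)) tt tt
K₄+pendant₁        = graphFromTable 5 (edgeIn ((1 , 4) ∷ K₄-edges)) tt tt
K₄+pendants₀₁      = graphFromTable 6 (edgeIn ((0 , 4) ∷ (1 , 5) ∷ K₄-edges)) tt tt
diamond+pendants₀₂ = graphFromTable 6
  (edgeIn ((0 , 1) ∷ (1 , 2) ∷ (2 , 3) ∷ (3 , 0) ∷ (1 , 3) ∷ (0 , 4) ∷ (2 , 5) ∷ [])) tt tt

module _ (G : Graph) (connected : Connected G) (noY : ¬ HasYSubgraph G)
         (maximal : ∀ k → HasEDCycle G k → k ≤ 4) where

  V : Set
  V = Fin (n G)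

  E : V → V → Set
  E = Edge G

  E-sym : ∀ {u v} → E u v → E v u
  E-sym {u} {v} = subst T (sym G u v)

  Corner : V → V → V → V → V → Set
  Corner a b c d u = u ≡ a ⊎ u ≡ b ⊎ u ≡ c ⊎ u ≡ d

  Outside : V → V → V → V → V → Set
  Outside a b c d u = ¬ Corner a b c d u

  corner? : ∀ a b c d u → Dec (Corner a b c d u)
  corner? a b c d u = u ≟ a ⊎-dec u ≟ b ⊎-dec u ≟ c ⊎-dec u ≟ d

  Corner-⊆ : ∀ {a b c d a′ b′ c′ d′} →
    Corner a b c d a′ → Corner a b c d b′ → Corner a b c d c′ → Corner a b c d d′ →
    ∀ {u} → Corner a′ b′ c′ d′ u → Corner a b c d u
  Corner-⊆ a′ b′ c′ d′ isA = a′
  Corner-⊆ a′ b′ c′ d′ isB = b′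
  Corner-⊆ a′ b′ c′ d′ isC = c′
  Corner-⊆ a′ b′ c′ d′ isD = d′

  Outside-⊇ : ∀ {a b c d a′ b′ c′ d′} →
    Corner a b c d a′ → Corner a b c d b′ → Corner a b c d c′ → Corner a b c d d′ →
    ∀ {u} → Outside a b c d u → Outside a′ b′ c′ d′ u
  Outside-⊇ a′ b′ c′ d′ o = o ∘ Corner-⊆ a′ b′ c′ d′

  OutsideNbr : V → V → V → V → V → Set
  OutsideNbr a b c d x = ∃ λ u → Outside a b c d u × E u x

  outsideNbr? : ∀ a b c d x → Dec (OutsideNbr a b c d x)
  outsideNbr? a b c d x = any? λ u → ¬? (corner? a b c d u) ×-dec T? (adj G u x)

  commonOutsideNbr? : ∀ a b c d x y → Dec (∃ λ u → Outside a b c d u × E u x × E u y)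
  commonOutsideNbr? a b c d x y = any? λ u → ¬? (corner? a b c d u) ×-dec T? (adj G u x) ×-dec T? (adj G u y)

  OutsideNbr-⊇ : ∀ {a b c d a′ b′ c′ d′ x} →
    Corner a b c d a′ → Corner a b c d b′ → Corner a b c d c′ → Corner a b c d d′ →
    OutsideNbr a b c d x → OutsideNbr a′ b′ c′ d′ x
  OutsideNbr-⊇ a′ b′ c′ d′ (u , o , e) = u , Outside-⊇ a′ b′ c′ d′ o , e

  module _ {a b c d u : V} (o : Outside a b c d u) where
    out≢a : u ≢ a
    out≢a = o ∘ inj₁
    out≢b : u ≢ b
    out≢b = o ∘ inj₂ ∘ inj₁
    out≢c : u ≢ c
    out≢c = o ∘ inj₂ ∘ inj₂ ∘ inj₁
    out≢d : u ≢ d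
    out≢d = o ∘ inj₂ ∘ inj₂ ∘ inj₂

  record Square (a b c d : V) : Set where
    field
      ab : E a b
      bc : E b c
      cd : E c d
      da : E d a
      a≢b : a ≢ b
      a≢c : a ≢ c
      a≢d : a ≢ d
      b≢c : b ≢ c
      b≢d : b ≢ d
      c≢d : c ≢ d
      dominating : ∀ u v → E u v → Corner a b c d u ⊎ Corner a b c d v

  rotate : ∀ {a b c d} → Square a b c d → Square b c d a
  rotate s = record
    { ab = bc ; bc = cd ; cd = da ; da = ab
    ; a≢b = b≢c ; a≢c = b≢d ; a≢d = ≢-sym a≢b ; b≢c = c≢d ; b≢d = ≢-sym a≢c ; c≢d = ≢-sym a≢d
    ; dominating = λ u v e → Sum.map (Corner-⊆ isD isA isB isC) (Corner-⊆ isD isA isB isC) (dominating u v e)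
    }
    where open Square s

  reflect : ∀ {a b c d} → Square a b c d → Square a d c b
  reflect s = record
    { ab = E-sym da ; bc = E-sym cd ; cd = E-sym bc ; da = E-sym ab
    ; a≢b = a≢d ; a≢c = a≢c ; a≢d = a≢b ; b≢c = ≢-sym c≢d ; b≢d = ≢-sym b≢d ; c≢d = ≢-sym b≢c
    ; dominating = λ u v e → Sum.map (Corner-⊆ isA isD isC isB) (Corner-⊆ isA isD isC isB) (dominating u v e)
    }
    where open Square s

  transpose : ∀ {a b c d} → E a c → E b d → Square a b c d → Square a c b d
  transpose ac bd s = record
    { ab = ac ; bc = E-sym bc ; cd = bd ; da = da
    ; a≢b = a≢c ; a≢c = a≢b ; a≢d = a≢d ; b≢c = ≢-sym b≢c ; b≢d = c≢d ; c≢d = b≢d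
    ; dominating = λ u v e → Sum.map (Corner-⊆ isA isC isB isD) (Corner-⊆ isA isC isB isD) (dominating u v e)
    }
    where open Square s

  square : HasEDCycle G 4 → ∃ λ a → ∃ λ b → ∃ λ c → ∃ λ d → Square a b c d
  square (C , edgeDominating) = v 0F , v 1F , v 2F , v 3F , record
    { ab = closed C 0F ; bc = closed C 1F ; cd = closed C 2F ; da = closed C 3F
    ; a≢b = λ e → case inj C {0F} {1F} e of λ ()
    ; a≢c = λ e → case inj C {0F} {2F} e of λ ()
    ; a≢d = λ e → case inj C {0F} {3F} e of λ ()
    ; b≢c = λ e → case inj C {1F} {2F} e of λ ()
    ; b≢d = λ e → case inj C {1F} {3F} e of λ ()
    ; c≢d = λ e → case inj C {2F} {3F} e of λ ()
    ; dominating = λ u w e → let (i , p) = edgeDominating u w e in Sum.map (onCycle i) (onCycle i) p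
    }
    where
    v = vtx C
    onCycle : ∀ i {u} → v i ≡ u → Corner (v 0F) (v 1F) (v 2F) (v 3F) u
    onCycle 0F refl = isA
    onCycle 1F refl = isB
    onCycle 2F refl = isC
    onCycle 3F refl = isD

  cycleOf : ∀ {k} (xs : Vec V k) → 3 ≤ k → Unique xs → (∀ i → E (lookup xs i) (lookup xs (nextF i))) → Cycle G k
  cycleOf xs 3≤k distinct closed = record
    { len≥3 = 3≤k ; vtx = lookup xs ; inj = lookup-injective distinct _ _ ; closed = closed }

  throughCorners⇒edgeDominating : ∀ {a b c d k} → Square a b c d → (C : Cycle G k) →
    (∀ {u} → Corner a b c d u → ∃ λ i → vtx C i ≡ u) → EdgeDominating G C
  throughCorners⇒edgeDominating s C hits u v e =
    [ (λ u∈ → let (i , p) = hits u∈ in i , inj₁ p) , (λ v∈ → let (i , p) = hits v∈ in i , inj₂ p) ]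
      (Square.dominating s u v e)

  ¬longCycleThroughCorners : ∀ {a b c d k} → Square a b c d → 5 ≤ k →
    (xs : Vec V k) → Unique xs → (∀ i → E (lookup xs i) (lookup xs (nextF i))) →
    (∀ {u} → Corner a b c d u → ∃ λ i → lookup xs i ≡ u) → ⊥
  ¬longCycleThroughCorners {k = k} s 5≤k xs distinct closed hits = <⇒≱ 5≤k (maximal k (C , dominating))
    where
    C = cycleOf xs (≤-trans (s≤s (s≤s (s≤s z≤n))) 5≤k) distinct closed
    dominating = throughCorners⇒edgeDominating s C hits

  ¬Y : ∀ {y₀ y₁ y₂ y₃ y₄ y₅ y₆} → Unique (y₀ ∷ y₁ ∷ y₂ ∷ y₃ ∷ y₄ ∷ y₅ ∷ y₆ ∷ []) →
       E y₀ y₁ → E y₀ y₂ → E y₀ y₃ → E y₁ y₄ → E y₂ y₅ → E y₃ y₆ → ⊥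
  ¬Y {y₀} {y₁} {y₂} {y₃} {y₄} {y₅} {y₆} distinct e₀₁ e₀₂ e₀₃ e₁₄ e₂₅ e₃₆ =
    noY (lookup (y₀ ∷ y₁ ∷ y₂ ∷ y₃ ∷ y₄ ∷ y₅ ∷ y₆ ∷ []) , lookup-injective distinct _ _ ,
         e₀₁ , e₀₂ , e₀₃ , e₁₄ , e₂₅ , e₃₆)

  module _ {a b c d : V} (s : Square a b c d) where
    open Square s

    outside-independent : ∀ {u v} → Outside a b c d u → Outside a b c d v → ¬ E u v
    outside-independent ou ov e = [ ou , ov ] (dominating _ _ e)

    -- The first edge of a walk from u to a is dominated, so it ends at a corner.
    outside-adjCorner : ∀ {u} → Outside a b c d u → E u a ⊎ E u b ⊎ E u c ⊎ E u d
    outside-adjCorner {u} o with connected u a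
    ... | here = ⊥-elim (o isA)
    ... | step {w = w} e _ with dominating u w e
    ...   | inj₁ u∈        = ⊥-elim (o u∈)
    ...   | inj₂ isA = inj₁ e
    ...   | inj₂ isB = inj₂ (inj₁ e)
    ...   | inj₂ isC = inj₂ (inj₂ (inj₁ e))
    ...   | inj₂ isD = inj₂ (inj₂ (inj₂ e))

    ¬adj-ab : ∀ {u} → Outside a b c d u → E u a → E u b → ⊥
    ¬adj-ab o ua ub = ¬longCycleThroughCorners s ≤-refl (a ∷ _ ∷ b ∷ c ∷ d ∷ [])
      ((≢-sym (out≢a o) ∷ a≢b ∷ a≢c ∷ a≢d ∷ []) ∷ (out≢b o ∷ out≢c o ∷ out≢d o ∷ []) ∷
       (b≢c ∷ b≢d ∷ []) ∷ (c≢d ∷ []) ∷ [] ∷ [])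
      (λ { 0F → E-sym ua ; 1F → ub ; 2F → bc ; 3F → cd ; 4F → da })
      (λ { isA → 0F , refl ; isB → 2F , refl ; isC → 3F , refl ; isD → 4F , refl })

    chordAC⇒¬adj-bd : ∀ {t} → E a c → Outside a b c d t → E t b → E t d → ⊥
    chordAC⇒¬adj-bd ac o tb td = ¬longCycleThroughCorners s ≤-refl (a ∷ c ∷ b ∷ _ ∷ d ∷ [])
      ((a≢c ∷ a≢b ∷ ≢-sym (out≢a o) ∷ a≢d ∷ []) ∷ (≢-sym b≢c ∷ ≢-sym (out≢c o) ∷ c≢d ∷ []) ∷
       (≢-sym (out≢b o) ∷ b≢d ∷ []) ∷ (out≢d o ∷ []) ∷ [] ∷ [])
      (λ { 0F → ac ; 1F → E-sym bc ; 2F → E-sym tb ; 3F → td ; 4F → da })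
      (λ { isA → 0F , refl ; isB → 2F , refl ; isC → 1F , refl ; isD → 4F , refl })

    ¬adj-ac∧adj-bd : ∀ {x t} → Outside a b c d x → E x a → E x c → Outside a b c d t → E t b → E t d → ⊥
    ¬adj-ac∧adj-bd ox xa xc ot tb td = ¬longCycleThroughCorners s (n≤1+n 5) (a ∷ _ ∷ c ∷ b ∷ _ ∷ d ∷ [])
      ((≢-sym (out≢a ox) ∷ a≢c ∷ a≢b ∷ ≢-sym (out≢a ot) ∷ a≢d ∷ []) ∷
       (out≢c ox ∷ out≢b ox ∷ x≢t ∷ out≢d ox ∷ []) ∷ (≢-sym b≢c ∷ ≢-sym (out≢c ot) ∷ c≢d ∷ []) ∷
       (≢-sym (out≢b ot) ∷ b≢d ∷ []) ∷ (out≢d ot ∷ []) ∷ [] ∷ [])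
      (λ { 0F → E-sym xa ; 1F → xc ; 2F → E-sym bc ; 3F → E-sym tb ; 4F → td ; 5F → da })
      (λ { isA → 0F , refl ; isB → 3F , refl ; isC → 2F , refl ; isD → 5F , refl })
      where
      x≢t : _ ≢ _
      x≢t refl = ¬adj-ab ox xa tb

  module _ {a b c d : V} (s : Square a b c d) where
    open Square s

    ¬adj-bc : ∀ {u} → Outside a b c d u → E u b → E u c → ⊥
    ¬adj-bc o = ¬adj-ab (rotate s) (Outside-⊇ isB isC isD isA o)

    ¬adj-cd : ∀ {u} → Outside a b c d u → E u c → E u d → ⊥
    ¬adj-cd o = ¬adj-ab (rotate (rotate s)) (Outside-⊇ isC isD isA isB o)

    ¬adj-da : ∀ {u} → Outside a b c d u → E u d → E u a → ⊥
    ¬adj-da o = ¬adj-ab (rotate (rotate (rotate s))) (Outside-⊇ isD isA isB isC o)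

    chordBD⇒¬adj-ca : ∀ {t} → E b d → Outside a b c d t → E t c → E t a → ⊥
    chordBD⇒¬adj-ca bd o = chordAC⇒¬adj-bd (rotate s) bd (Outside-⊇ isB isC isD isA o)

    shapeOf : ∀ {u} → Outside a b c d u → OutsideShape (adj G u a) (adj G u b) (adj G u c) (adj G u d)
    shapeOf o = outsideShape _ _ _ _ (¬adj-ab s o) (¬adj-bc o) (¬adj-cd o) (¬adj-da o) (outside-adjCorner s o)

    -- Each of the following exhibits a Y: centred at a with legs through b, c, d; centred at b with legs
    -- a la, c lc and x d; centred at b with legs through a, c, d.
    chordAC⇒¬outsideNbrs-b-c-d : ∀ {lb lc ld} → E a c →
      Outside a b c d lb → E lb b → Outside a b c d lc → E lc c → Outside a b c d ld → E ld d → ⊥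
    chordAC⇒¬outsideNbrs-b-c-d ac olb lbb olc lcc old ldd = ¬Y
      ((a≢b ∷ a≢c ∷ a≢d ∷ ≢-sym (out≢a olb) ∷ ≢-sym (out≢a olc) ∷ ≢-sym (out≢a old) ∷ []) ∷
       (b≢c ∷ b≢d ∷ ≢-sym (out≢b olb) ∷ ≢-sym (out≢b olc) ∷ ≢-sym (out≢b old) ∷ []) ∷
       (c≢d ∷ ≢-sym (out≢c olb) ∷ ≢-sym (out≢c olc) ∷ ≢-sym (out≢c old) ∷ []) ∷
       (≢-sym (out≢d olb) ∷ ≢-sym (out≢d olc) ∷ ≢-sym (out≢d old) ∷ []) ∷
       (lb≢lc ∷ lb≢ld ∷ []) ∷ (lc≢ld ∷ []) ∷ [] ∷ [])
      ab ac (E-sym da) (E-sym lbb) (E-sym lcc) (E-sym ldd)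
      where
      lb≢lc : _ ≢ _
      lb≢lc refl = ¬adj-bc olb lbb lcc
      lb≢ld : _ ≢ _
      lb≢ld refl = chordAC⇒¬adj-bd s ac olb lbb ldd
      lc≢ld : _ ≢ _
      lc≢ld refl = ¬adj-cd olc lcc ldd

    ¬outsideNbrs-a-c-bd : ∀ {la lc x} →
      Outside a b c d la → E la a → ¬ E la c → Outside a b c d lc → E lc c →
      Outside a b c d x → E x b → E x d → ⊥
    ¬outsideNbrs-a-c-bd ola laa ¬lac olc lcc ox xb xd = ¬Y
      ((≢-sym a≢b ∷ b≢c ∷ ≢-sym (out≢b ox) ∷ ≢-sym (out≢b ola) ∷ ≢-sym (out≢b olc) ∷ b≢d ∷ []) ∷
       (a≢c ∷ ≢-sym (out≢a ox) ∷ ≢-sym (out≢a ola) ∷ ≢-sym (out≢a olc) ∷ a≢d ∷ []) ∷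
       (≢-sym (out≢c ox) ∷ ≢-sym (out≢c ola) ∷ ≢-sym (out≢c olc) ∷ c≢d ∷ []) ∷
       (x≢la ∷ x≢lc ∷ out≢d ox ∷ []) ∷
       (la≢lc ∷ out≢d ola ∷ []) ∷ (out≢d olc ∷ []) ∷ [] ∷ [])
      (E-sym ab) bc (E-sym xb) (E-sym laa) (E-sym lcc) xd
      where
      x≢la : _ ≢ _
      x≢la refl = ¬adj-ab s ox laa xb
      x≢lc : _ ≢ _
      x≢lc refl = ¬adj-bc ox xb lcc
      la≢lc : _ ≢ _
      la≢lc refl = ¬lac lcc

    chordBD⇒¬outsideNbrs-a-c-d : ∀ {la lc ld} → E b d →
      Outside a b c d la → E la a → ¬ E la c → Outside a b c d lc → E lc c → Outside a b c d ld → E ld d → ⊥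
    chordBD⇒¬outsideNbrs-a-c-d bd ola laa ¬lac olc lcc old ldd = ¬Y
      ((≢-sym a≢b ∷ b≢c ∷ b≢d ∷ ≢-sym (out≢b ola) ∷ ≢-sym (out≢b olc) ∷ ≢-sym (out≢b old) ∷ []) ∷
       (a≢c ∷ a≢d ∷ ≢-sym (out≢a ola) ∷ ≢-sym (out≢a olc) ∷ ≢-sym (out≢a old) ∷ []) ∷
       (c≢d ∷ ≢-sym (out≢c ola) ∷ ≢-sym (out≢c olc) ∷ ≢-sym (out≢c old) ∷ []) ∷
       (≢-sym (out≢d ola) ∷ ≢-sym (out≢d olc) ∷ ≢-sym (out≢d old) ∷ []) ∷
       (la≢lc ∷ la≢ld ∷ []) ∷ (lc≢ld ∷ []) ∷ [] ∷ [])
      (E-sym ab) bc bd (E-sym laa) (E-sym lcc) (E-sym ldd)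
      where
      la≢lc : _ ≢ _
      la≢lc refl = ¬lac lcc
      la≢ld : _ ≢ _
      la≢ld refl = ¬adj-da old ldd laa
      lc≢ld : _ ≢ _
      lc≢ld refl = ¬adj-cd olc lcc ldd

  module _ {a b c d : V} (s : Square a b c d) where
    open Square s

    cornerVertex : Fin 4 → V
    cornerVertex = lookup (a ∷ b ∷ c ∷ d ∷ [])

    cornerVertex-injective : ∀ i j → cornerVertex i ≡ cornerVertex j → i ≡ j
    cornerVertex-injective =
      lookup-injective ((a≢b ∷ a≢c ∷ a≢d ∷ []) ∷ (b≢c ∷ b≢d ∷ []) ∷ (c≢d ∷ []) ∷ [] ∷ [])

    cornerVertex-isCorner : ∀ i → Corner a b c d (cornerVertex i)
    cornerVertex-isCorner 0F = isA
    cornerVertex-isCorner 1F = isB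
    cornerVertex-isCorner 2F = isC
    cornerVertex-isCorner 3F = isD

    outsideProfile : V → Profile
    outsideProfile u = outside (adj G u a) (adj G u b) (adj G u c) (adj G u d)

    profile : V → Profile
    profile u with corner? a b c d u
    ... | yes (inj₁ _)               = corner 0F
    ... | yes (inj₂ (inj₁ _))        = corner 1F
    ... | yes (inj₂ (inj₂ (inj₁ _))) = corner 2F
    ... | yes (inj₂ (inj₂ (inj₂ _))) = corner 3F
    ... | no _                       = outsideProfile u

    data ProfileView (u : V) : Profile → Set where
      atCorner  : ∀ i → u ≡ cornerVertex i → ProfileView u (corner i)
      isOutside : Outside a b c d u → ProfileView u (outsideProfile u)

    profileView : ∀ u → ProfileView u (profile u)
    profileView u with corner? a b c d u
    ... | yes (inj₁ p)               = atCorner 0F p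
    ... | yes (inj₂ (inj₁ p))        = atCorner 1F p
    ... | yes (inj₂ (inj₂ (inj₁ p))) = atCorner 2F p
    ... | yes (inj₂ (inj₂ (inj₂ p))) = atCorner 3F p
    ... | no o                       = isOutside o

    profile-cornerVertex : ∀ i → profile (cornerVertex i) ≡ corner i
    profile-cornerVertex i with profile (cornerVertex i) | profileView (cornerVertex i)
    ... | _ | atCorner j e = cong corner (cornerVertex-injective j i (≡.sym e))
    ... | _ | isOutside o  = ⊥-elim (o (cornerVertex-isCorner i))

    profile≡corner⇒ : ∀ {u i} → profile u ≡ corner i → u ≡ cornerVertex i
    profile≡corner⇒ {u} e with profile u | profileView u
    profile≡corner⇒ refl | _ | atCorner _ p = p
    profile≡corner⇒ ()   | _ | isOutside _

    profile-outside : ∀ {u} → Outside a b c d u → profile u ≡ outsideProfile u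
    profile-outside {u} o with profile u | profileView u
    ... | _ | atCorner i refl = ⊥-elim (o (cornerVertex-isCorner i))
    ... | _ | isOutside _     = refl

    adj-cornerVertex : ∀ i j → adj G (cornerVertex i) (cornerVertex j) ≡ cornerAdj (adj G a c) (adj G b d) i j
    adj-cornerVertex 0F 0F = irrefl G a
    adj-cornerVertex 0F 1F = Equivalence.to T-≡ ab
    adj-cornerVertex 0F 2F = refl
    adj-cornerVertex 0F 3F = Equivalence.to T-≡ (E-sym da)
    adj-cornerVertex 1F 0F = Equivalence.to T-≡ (E-sym ab)
    adj-cornerVertex 1F 1F = irrefl G b
    adj-cornerVertex 1F 2F = Equivalence.to T-≡ bc
    adj-cornerVertex 1F 3F = refl
    adj-cornerVertex 2F 0F = sym G c a
    adj-cornerVertex 2F 1F = Equivalence.to T-≡ (E-sym bc)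
    adj-cornerVertex 2F 2F = irrefl G c
    adj-cornerVertex 2F 3F = Equivalence.to T-≡ cd
    adj-cornerVertex 3F 0F = Equivalence.to T-≡ da
    adj-cornerVertex 3F 1F = sym G d b
    adj-cornerVertex 3F 2F = Equivalence.to T-≡ (E-sym cd)
    adj-cornerVertex 3F 3F = irrefl G d

    adj-toCornerVertex : ∀ i v → adj G v (cornerVertex i) ≡ adjToCorner i (adj G v a) (adj G v b) (adj G v c) (adj G v d)
    adj-toCornerVertex 0F v = refl
    adj-toCornerVertex 1F v = refl
    adj-toCornerVertex 2F v = refl
    adj-toCornerVertex 3F v = refl

    -- Outside vertices are pairwise non-adjacent, so adjacency depends only on profiles.
    adj≡squareAdj : ∀ u v → adj G u v ≡ squareAdj (adj G a c) (adj G b d) (profile u) (profile v)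
    adj≡squareAdj u v with profile u | profileView u | profile v | profileView v
    ... | _ | atCorner i refl | _ | atCorner j refl = adj-cornerVertex i j
    ... | _ | atCorner i refl | _ | isOutside _     = trans (sym G (cornerVertex i) v) (adj-toCornerVertex i v)
    ... | _ | isOutside _     | _ | atCorner j refl = adj-toCornerVertex j u
    ... | _ | isOutside ou    | _ | isOutside ov    =
      ¬T⇒≡false (outside-independent s ou ov)

    profile-allowed : ∀ {pA pB pC pD pAC pBD} →
      (∀ {u} → Outside a b c d u → E u a → T pA) → (∀ {u} → Outside a b c d u → E u b → T pB) →
      (∀ {u} → Outside a b c d u → E u c → T pC) → (∀ {u} → Outside a b c d u → E u d → T pD) →
      (∀ {u} → Outside a b c d u → E u a → E u c → T pAC) → (∀ {u} → Outside a b c d u → E u b → E u d → T pBD) →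
      ∀ u → T (allowed pA pB pC pD pAC pBD (profile u))
    profile-allowed hA hB hC hD hAC hBD u with profile u | profileView u
    ... | _ | atCorner _ _ = tt
    ... | _ | isOutside o  = allowed-shape (shapeOf s o) (hA o) (hB o) (hC o) (hD o) (hAC o) (hBD o)

    adj-factors : ∀ {K : Set} {ac bd} (ok : Profile → Bool) → (∀ u → T (ok (profile u))) →
      (σ : Profile → K) (R : K → K → Bool) → adj G a c ≡ ac → adj G b d ≡ bd →
      T (everyProfile² λ x y → ok x ⇒ᵇ ok y ⇒ᵇ squareAdj ac bd x y ==ᵇ R (σ x) (σ y)) →
      ∀ u v → adj G u v ≡ R (σ (profile u)) (σ (profile v))
    adj-factors ok ok-profile σ R refl refl check u v = trans (adj≡squareAdj u v) (==ᵇ-sound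
      (⇒ᵇ-elim (⇒ᵇ-elim
        (everyProfile²-sound (λ x y → ok x ⇒ᵇ ok y ⇒ᵇ squareAdj _ _ x y ==ᵇ R (σ x) (σ y)) check (profile u) (profile v))
        (ok-profile u)) (ok-profile v)))

    σ-outsideNbr : ∀ {K : Set} (ok : Profile → Bool) → (∀ u → T (ok (profile u))) → (σ : Profile → K) →
      (_≟ᵇ_ : K → K → Bool) → (∀ {x y} → T (x ≟ᵇ y) → x ≡ y) → ∀ i h →
      T (everyProfile λ x → ok x ⇒ᵇ outsideAdjToCorner i x ⇒ᵇ σ x ≟ᵇ h) →
      ∀ {u} → Outside a b c d u → E u (cornerVertex i) → σ (profile u) ≡ h
    σ-outsideNbr ok ok-profile σ _≟ᵇ_ sound i h check {u} o e = sound (⇒ᵇ-elim (⇒ᵇ-elim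
      (everyProfile-sound (λ x → ok x ⇒ᵇ outsideAdjToCorner i x ⇒ᵇ σ x ≟ᵇ h) check (profile u)) (ok-profile u))
      (subst (λ x → T (outsideAdjToCorner i x)) (≡.sym (profile-outside o)) (subst T (adj-toCornerVertex i u) e)))

    sameCorner⇒≡ : ∀ u v → T (sameCorner (profile u) (profile v)) → u ≡ v
    sameCorner⇒≡ u v t with profile u | profileView u | profile v | profileView v
    ... | _ | atCorner i refl | _ | atCorner j refl = cong cornerVertex (=ᶠ-sound t)
    ... | _ | atCorner _ _    | _ | isOutside _     = ⊥-elim t
    ... | _ | isOutside _     | _ | atCorner _ _    = ⊥-elim t
    ... | _ | isOutside _     | _ | isOutside _     = ⊥-elim t

    cornerVertex-onto : ∀ {K : Set} (σ : Profile → K) i → ∃ λ u → σ (profile u) ≡ σ (corner i)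
    cornerVertex-onto σ i = cornerVertex i , cong σ (profile-cornerVertex i)

    clonedFrom : ∀ {ac bd} (H : Graph) → n H ≤ 6 → (ok : Profile → Bool) → (∀ u → T (ok (profile u))) →
      (σ : Profile → Fin (n H)) → adj G a c ≡ ac → adj G b d ≡ bd →
      T (everyProfile² λ x y → ok x ⇒ᵇ ok y ⇒ᵇ squareAdj ac bd x y ==ᵇ adj H (σ x) (σ y)) →
      T (everyProfile² λ x y → ok x ⇒ᵇ ok y ⇒ᵇ σ x =ᶠ σ y ⇒ᵇ sameCorner x y ∨ isLeafᵇ H (σ x)) →
      (∀ h → ∃ λ u → σ (profile u) ≡ h) → FromSmallByCloningLeaves 6 G
    clonedFrom H n≤6 ok ok-profile σ ac≡ bd≡ adjCheck fibreCheck onto =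
      H , n≤6 , p , (λ h → let (u , e) = onto h in u , λ { refl → e }) ,
      adj-factors ok ok-profile σ (adj H) ac≡ bd≡ adjCheck , fibre
      where
      p : V → Fin (n H)
      p u = σ (profile u)
      fibre : ∀ u v → u ≢ v → p u ≡ p v → IsLeaf H (p u)
      fibre u v u≢v pu≡pv with Equivalence.to (T-∨ {sameCorner (profile u) (profile v)})
        (⇒ᵇ-elim (⇒ᵇ-elim (⇒ᵇ-elim
          (everyProfile²-sound (λ x y → ok x ⇒ᵇ ok y ⇒ᵇ σ x =ᶠ σ y ⇒ᵇ sameCorner x y ∨ isLeafᵇ H (σ x))
            fibreCheck (profile u) (profile v))
          (ok-profile u)) (ok-profile v)) (=ᶠ-complete pu≡pv))
      ... | inj₁ same = ⊥-elim (u≢v (sameCorner⇒≡ u v same))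
      ... | inj₂ leaf = ≡ᵇ⇒≡ _ 1 leaf

    necklaceFrom : ∀ {m ac bd} (bt : Fin (2 + m) → Bead) (hasEdge : Fin (2 + m) → Bool) →
      (∀ b → primEdge (bt b) ≡ hasEdge b) → (∀ b → ¬ IsK211 (bt b)) →
      (m ≡ 0 → ¬ (IsK11 (bt zero) × IsK11 (bt (suc zero)))) →
      (ok : Profile → Bool) → (∀ u → T (ok (profile u))) →
      (σ : Profile → Role (2 + m)) (τ : Fin (2 + m) → Fin 4) → adj G a c ≡ ac → adj G b d ≡ bd →
      T (everyProfile² λ x y → ok x ⇒ᵇ ok y ⇒ᵇ squareAdj ac bd x y ==ᵇ roleAdj hasEdge (σ x) (σ y)) →
      T (everyFin λ i → sameRole (σ (corner (τ i))) (primary i)) →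
      T (everyProfile λ x → ok x ⇒ᵇ everyFin λ i → sameRole (σ x) (primary i) ⇒ᵇ sameCorner x (corner (τ i))) →
      (∀ b → count (λ u → sameRole (σ (profile u)) (inner b)) ≡ innerSize (bt b)) → IsSpikedNecklace G
    necklaceFrom {m} bt hasEdge primEdge≡ ¬K211 ¬twoK11 ok ok-profile σ τ ac≡ bd≡ adjCheck τ-primary primary-τ inners =
      SpikedNecklaceFromRoles.isSpikedNecklace G m bt hasEdge primEdge≡ ¬K211 ¬twoK11
        (σ ∘ profile) (cornerVertex ∘ τ) role-primaryVertex role≡primary⇒ inners
        (adj-factors ok ok-profile σ (roleAdj hasEdge) ac≡ bd≡ adjCheck)
      where
      role-primaryVertex : ∀ i → σ (profile (cornerVertex (τ i))) ≡ primary i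
      role-primaryVertex i = trans (cong σ (profile-cornerVertex (τ i)))
        (sameRole-sound _ _ (everyFin-sound (λ i → sameRole (σ (corner (τ i))) (primary i)) τ-primary i))
      role≡primary⇒ : ∀ u i → σ (profile u) ≡ primary i → u ≡ cornerVertex (τ i)
      role≡primary⇒ u i e = profile≡corner⇒ (sameCorner-corner (profile u) (τ i) (⇒ᵇ-elim
        (everyFin-sound (λ i → sameRole (σ (profile u)) (primary i) ⇒ᵇ sameCorner (profile u) (corner (τ i)))
          (⇒ᵇ-elim (everyProfile-sound
          (λ x → ok x ⇒ᵇ everyFin λ i → sameRole (σ x) (primary i) ⇒ᵇ sameCorner x (corner (τ i)))
          primary-τ (profile u)) (ok-profile u)) i)
        (subst (λ y → T (sameRole y (primary i))) (≡.sym e) (sameRole-refl (primary i)))))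

    count-noInner : ∀ {r} (σ : Profile → Role r) b → T (everyProfile λ x → not (sameRole (σ x) (inner b))) →
      count (λ u → sameRole (σ (profile u)) (inner b)) ≡ 0
    count-noInner σ b check = count-none _ λ u →
      Equivalence.to T-not-≡ (everyProfile-sound (λ x → not (sameRole (σ x) (inner b))) check (profile u))

    threeBeads : ∀ {bd} → adj G a c ≡ false → adj G b d ≡ bd → (∀ {u} → Outside a b c d u → ¬ E u c) →
      (bd ≡ false → ∃ λ u → Outside a b c d u × E u b × E u d) → IsSpikedNecklace G
    threeBeads {bd} ac≡ bd≡ ¬nbrC bdNbr =
      necklaceFrom bt (hasEdge₃ bd) primEdge≡ ¬K211 (λ ()) ok ok-profile roles₃ primaryCorner₃ ac≡ bd≡
        (adjCheck bd) tt tt inners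
      where
      ok = allowed true true false true false true
      ok-profile : ∀ u → T (ok (profile u))
      ok-profile = profile-allowed (λ _ _ → tt) (λ _ _ → tt) (λ o → ⊥-elim ∘ ¬nbrC o) (λ _ _ → tt)
        (λ o _ → ⊥-elim ∘ ¬nbrC o) (λ _ _ _ → tt)
      adjCheck : ∀ bd → T (everyProfile² λ x y → ok x ⇒ᵇ ok y ⇒ᵇ
        squareAdj false bd x y ==ᵇ roleAdj (hasEdge₃ bd) (roles₃ x) (roles₃ y))
      adjCheck true  = tt
      adjCheck false = tt
      InnerBD : V → Bool
      InnerBD u = sameRole (roles₃ (profile u)) (inner 1F)
      2≤inners : bd ≡ false → 2 ≤ count InnerBD
      2≤inners bd≡false with bdNbr bd≡false
      ... | u , o , ub , ud = count-two InnerBD u c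
        (subst (λ x → T (sameRole (roles₃ x) (inner 1F)))
               (≡.sym (trans (profile-outside o) (shape-BD (shapeOf s o) ub ud))) tt)
        (subst (λ x → T (sameRole (roles₃ x) (inner 1F))) (≡.sym (profile-cornerVertex 2F)) tt)
        (out≢c o)
      bt : Fin 3 → Bead
      bt 0F = K11 0
      bt 1F = beadOn bd (count InnerBD) 2≤inners
      bt 2F = K11 0
      primEdge≡ : ∀ b → primEdge (bt b) ≡ hasEdge₃ bd b
      primEdge≡ 0F = refl
      primEdge≡ 1F = primEdge-beadOn bd _ _
      primEdge≡ 2F = refl
      ¬K211 : ∀ b → ¬ IsK211 (bt b)
      ¬K211 0F ()
      ¬K211 1F = ¬K211-beadOn bd _ _
      ¬K211 2F ()
      inners : ∀ b → count (λ u → sameRole (roles₃ (profile u)) (inner b)) ≡ innerSize (bt b)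
      inners 0F = count-noInner roles₃ 0F tt
      inners 1F = ≡.sym (innerSize-beadOn bd _ _)
      inners 2F = count-noInner roles₃ 2F tt

    fourBeads : adj G a c ≡ false → adj G b d ≡ false →
      (∀ {u} → Outside a b c d u → E u a → E u c → ⊥) → (∀ {u} → Outside a b c d u → E u b → E u d → ⊥) →
      IsSpikedNecklace G
    fourBeads ac≡ bd≡ ¬nbrAC ¬nbrBD =
      necklaceFrom (λ _ → K11 0) (λ _ → true) (λ _ → refl) (λ _ ()) (λ ()) ok ok-profile roles₄ id ac≡ bd≡
        tt tt tt (λ b → count-noInner roles₄ b (noInner b))
      where
      ok = allowed true true true true false false
      ok-profile : ∀ u → T (ok (profile u))
      ok-profile = profile-allowed (λ _ _ → tt) (λ _ _ → tt) (λ _ _ → tt) (λ _ _ → tt)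
        (λ o ua → ⊥-elim ∘ ¬nbrAC o ua) (λ o ub → ⊥-elim ∘ ¬nbrBD o ub)
      noInner : ∀ b → T (everyProfile λ x → not (sameRole (roles₄ x) (inner b)))
      noInner 0F = tt
      noInner 1F = tt
      noInner 2F = tt
      noInner 3F = tt

    hasNbr : ∀ {x} (nbr? : Dec (OutsideNbr a b c d x)) {u} → Outside a b c d u → E u x → T ⌊ nbr? ⌋
    hasNbr (yes _) o e = tt
    hasNbr (no ¬n) o e = ¬n (_ , o , e)

    k₄WithPendants : E a c → E b d → ¬ OutsideNbr a b c d c → ¬ OutsideNbr a b c d d →
      FromSmallByCloningLeaves 6 G
    k₄WithPendants ac bd ¬nbrC ¬nbrD = cases (outsideNbr? a b c d a) (outsideNbr? a b c d b)
      where
      ac≡ = Equivalence.to T-≡ ac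
      bd≡ = Equivalence.to T-≡ bd
      ok : Dec (OutsideNbr a b c d a) → Dec (OutsideNbr a b c d b) → Profile → Bool
      ok nbrA? nbrB? = allowed ⌊ nbrA? ⌋ ⌊ nbrB? ⌋ false false false false
      ok-profile : ∀ nbrA? nbrB? u → T (ok nbrA? nbrB? (profile u))
      ok-profile nbrA? nbrB? = profile-allowed (hasNbr nbrA?) (hasNbr nbrB?)
        (λ o e → ¬nbrC (_ , o , e)) (λ o e → ¬nbrD (_ , o , e))
        (λ o ua uc → chordBD⇒¬adj-ca s bd o uc ua) (λ o ub ud → chordAC⇒¬adj-bd s ac o ub ud)
      cases : Dec (OutsideNbr a b c d a) → Dec (OutsideNbr a b c d b) → FromSmallByCloningLeaves 6 G
      cases nbrA?@(yes (la , ola , laa)) nbrB?@(yes (lb , olb , lbb)) =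
        clonedFrom K₄+pendants₀₁ ≤-refl (ok nbrA? nbrB?) (ok-profile nbrA? nbrB?) σ ac≡ bd≡ tt tt onto
        where
        σ = pendantsTo {2} 4F 5F 0F 0F
        onto : ∀ h → ∃ λ u → σ (profile u) ≡ h
        onto 0F = cornerVertex-onto σ 0F
        onto 1F = cornerVertex-onto σ 1F
        onto 2F = cornerVertex-onto σ 2F
        onto 3F = cornerVertex-onto σ 3F
        onto 4F = la , σ-outsideNbr (ok nbrA? nbrB?) (ok-profile nbrA? nbrB?) σ _=ᶠ_ =ᶠ-sound 0F 4F tt ola laa
        onto 5F = lb , σ-outsideNbr (ok nbrA? nbrB?) (ok-profile nbrA? nbrB?) σ _=ᶠ_ =ᶠ-sound 1F 5F tt olb lbb
      cases nbrA?@(yes (la , ola , laa)) nbrB?@(no _) =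
        clonedFrom K₄+pendant₀ (n≤1+n 5) (ok nbrA? nbrB?) (ok-profile nbrA? nbrB?) σ ac≡ bd≡ tt tt onto
        where
        σ = pendantsTo {1} 4F 0F 0F 0F
        onto : ∀ h → ∃ λ u → σ (profile u) ≡ h
        onto 0F = cornerVertex-onto σ 0F
        onto 1F = cornerVertex-onto σ 1F
        onto 2F = cornerVertex-onto σ 2F
        onto 3F = cornerVertex-onto σ 3F
        onto 4F = la , σ-outsideNbr (ok nbrA? nbrB?) (ok-profile nbrA? nbrB?) σ _=ᶠ_ =ᶠ-sound 0F 4F tt ola laa
      cases nbrA?@(no _) nbrB?@(yes (lb , olb , lbb)) =
        clonedFrom K₄+pendant₁ (n≤1+n 5) (ok nbrA? nbrB?) (ok-profile nbrA? nbrB?) σ ac≡ bd≡ tt tt onto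
        where
        σ = pendantsTo {1} 0F 4F 0F 0F
        onto : ∀ h → ∃ λ u → σ (profile u) ≡ h
        onto 0F = cornerVertex-onto σ 0F
        onto 1F = cornerVertex-onto σ 1F
        onto 2F = cornerVertex-onto σ 2F
        onto 3F = cornerVertex-onto σ 3F
        onto 4F = lb , σ-outsideNbr (ok nbrA? nbrB?) (ok-profile nbrA? nbrB?) σ _=ᶠ_ =ᶠ-sound 1F 4F tt olb lbb
      cases nbrA?@(no _) nbrB?@(no _) =
        clonedFrom K₄ (≤-trans (n≤1+n 4) (n≤1+n 5)) (ok nbrA? nbrB?) (ok-profile nbrA? nbrB?) σ ac≡ bd≡ tt tt onto
        where
        σ = pendantsTo {0} 0F 0F 0F 0F
        onto : ∀ h → ∃ λ u → σ (profile u) ≡ h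
        onto 0F = cornerVertex-onto σ 0F
        onto 1F = cornerVertex-onto σ 1F
        onto 2F = cornerVertex-onto σ 2F
        onto 3F = cornerVertex-onto σ 3F

    diamondWithPendants : adj G a c ≡ false → E b d → ¬ OutsideNbr a b c d b → ¬ OutsideNbr a b c d d →
      OutsideNbr a b c d a → OutsideNbr a b c d c → FromSmallByCloningLeaves 6 G
    diamondWithPendants ac≡ bd ¬nbrB ¬nbrD (la , ola , laa) (lc , olc , lcc) =
      clonedFrom diamond+pendants₀₂ ≤-refl ok ok-profile σ ac≡ (Equivalence.to T-≡ bd) tt tt onto
      where
      ok = allowed true false true false false false
      ok-profile : ∀ u → T (ok (profile u))
      ok-profile = profile-allowed (λ _ _ → tt) (λ o e → ¬nbrB (_ , o , e)) (λ _ _ → tt) (λ o e → ¬nbrD (_ , o , e))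
        (λ o ua uc → chordBD⇒¬adj-ca s bd o uc ua) (λ o ub _ → ¬nbrB (_ , o , ub))
      σ = pendantsTo {2} 4F 0F 5F 0F
      onto : ∀ h → ∃ λ u → σ (profile u) ≡ h
      onto 0F = cornerVertex-onto σ 0F
      onto 1F = cornerVertex-onto σ 1F
      onto 2F = cornerVertex-onto σ 2F
      onto 3F = cornerVertex-onto σ 3F
      onto 4F = la , σ-outsideNbr ok ok-profile σ _=ᶠ_ =ᶠ-sound 0F 4F tt ola laa
      onto 5F = lc , σ-outsideNbr ok ok-profile σ _=ᶠ_ =ᶠ-sound 2F 5F tt olc lcc

  Conclusion : Set
  Conclusion = FromSmallByCloningLeaves 6 G ⊎ IsSpikedNecklace G

  -- Three corners with outside neighbours give a Y centred at the fourth, and in K₄ any two corners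
  -- without outside neighbours can be moved to positions c and d.
  bothChords : ∀ {a b c d} → Square a b c d → E a c → E b d → Conclusion
  bothChords {a} {b} {c} {d} s ac bd
    with outsideNbr? a b c d a | outsideNbr? a b c d b | outsideNbr? a b c d c | outsideNbr? a b c d d
  ... | yes (_ , ola , laa) | yes (_ , olb , lbb) | yes (_ , olc , lcc) | _ = ⊥-elim
    (chordAC⇒¬outsideNbrs-b-c-d (rotate (rotate (rotate s))) (E-sym bd)
      (Outside-⊇ isD isA isB isC ola) laa (Outside-⊇ isD isA isB isC olb) lbb (Outside-⊇ isD isA isB isC olc) lcc)
  ... | _ | yes (_ , olb , lbb) | yes (_ , olc , lcc) | yes (_ , old , ldd) = ⊥-elim
    (chordAC⇒¬outsideNbrs-b-c-d s ac olb lbb olc lcc old ldd)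
  ... | yes (_ , ola , laa) | _ | yes (_ , olc , lcc) | yes (_ , old , ldd) = ⊥-elim
    (chordAC⇒¬outsideNbrs-b-c-d (rotate s) bd
      (Outside-⊇ isB isC isD isA olc) lcc (Outside-⊇ isB isC isD isA old) ldd (Outside-⊇ isB isC isD isA ola) laa)
  ... | yes (_ , ola , laa) | yes (_ , olb , lbb) | _ | yes (_ , old , ldd) = ⊥-elim
    (chordAC⇒¬outsideNbrs-b-c-d (rotate (rotate s)) (E-sym ac)
      (Outside-⊇ isC isD isA isB old) ldd (Outside-⊇ isC isD isA isB ola) laa (Outside-⊇ isC isD isA isB olb) lbb)
  ... | _ | _ | no ¬c | no ¬d = inj₁ (k₄WithPendants s ac bd ¬c ¬d)
  ... | no ¬a | _ | _ | no ¬d = inj₁ (k₄WithPendants (rotate s) bd (E-sym ac)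
    (¬d ∘ OutsideNbr-⊇ isD isA isB isC) (¬a ∘ OutsideNbr-⊇ isD isA isB isC))
  ... | no ¬a | no ¬b | _ | _ = inj₁ (k₄WithPendants (rotate (rotate s)) (E-sym ac) (E-sym bd)
    (¬a ∘ OutsideNbr-⊇ isC isD isA isB) (¬b ∘ OutsideNbr-⊇ isC isD isA isB))
  ... | _ | no ¬b | no ¬c | _ = inj₁ (k₄WithPendants (rotate (rotate (rotate s))) (E-sym bd) ac
    (¬b ∘ OutsideNbr-⊇ isB isC isD isA) (¬c ∘ OutsideNbr-⊇ isB isC isD isA))
  ... | _ | no ¬b | _ | no ¬d = inj₁ (k₄WithPendants (transpose ac bd s) (Square.ab s) (Square.cd s)
    (¬b ∘ OutsideNbr-⊇ isA isC isB isD) (¬d ∘ OutsideNbr-⊇ isA isC isB isD))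
  ... | no ¬a | _ | no ¬c | _ = inj₁ (k₄WithPendants (transpose bd (E-sym ac) (rotate s)) (Square.bc s) (Square.da s)
    (¬c ∘ OutsideNbr-⊇ isD isA isC isB) (¬a ∘ OutsideNbr-⊇ isD isA isC isB))

  oneChord : ∀ {a b c d} → Square a b c d → adj G a c ≡ false → E b d → Conclusion
  oneChord {a} {b} {c} {d} s ac≡ bd with outsideNbr? a b c d c | outsideNbr? a b c d a
  ... | no ¬c | _ = inj₂ (threeBeads s ac≡ (Equivalence.to T-≡ bd) (λ o e → ¬c (_ , o , e)) λ ())
  ... | yes _ | no ¬a = inj₂ (threeBeads (reflect (rotate (rotate s))) (trans (sym G c a) ac≡) (Equivalence.to T-≡ bd)
    (λ o e → ¬a (_ , Outside-⊇ isC isB isA isD o , e)) λ ())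
  ... | yes nbrC@(_ , olc , lcc) | yes nbrA@(_ , ola , laa) with outsideNbr? a b c d b | outsideNbr? a b c d d
  ...   | yes (_ , olb , lbb) | _ = ⊥-elim (chordBD⇒¬outsideNbrs-a-c-d (reflect s) (E-sym bd)
    (Outside-⊇ isA isD isC isB ola) laa ¬lac (Outside-⊇ isA isD isC isB olc) lcc (Outside-⊇ isA isD isC isB olb) lbb)
    where ¬lac = λ lac → chordBD⇒¬adj-ca s bd ola lac laa
  ...   | no _ | yes (_ , old , ldd) = ⊥-elim (chordBD⇒¬outsideNbrs-a-c-d s bd ola laa ¬lac olc lcc old ldd)
    where ¬lac = λ lac → chordBD⇒¬adj-ca s bd ola lac laa
  ...   | no ¬b | no ¬d = inj₁ (diamondWithPendants s ac≡ bd ¬b ¬d nbrA nbrC)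

  noChordWithBDNbr : ∀ {a b c d} → Square a b c d → adj G a c ≡ false → adj G b d ≡ false →
    ∃ (λ u → Outside a b c d u × E u b × E u d) → Conclusion
  noChordWithBDNbr {a} {b} {c} {d} s ac≡ bd≡ bdNbr@(_ , ox , xb , xd) with outsideNbr? a b c d c | outsideNbr? a b c d a
  ... | no ¬c | _ = inj₂ (threeBeads s ac≡ bd≡ (λ o e → ¬c (_ , o , e)) λ _ → bdNbr)
  ... | yes _ | no ¬a = inj₂ (threeBeads (reflect (rotate (rotate s))) (trans (sym G c a) ac≡) bd≡
    (λ o e → ¬a (_ , Outside-⊇ isC isB isA isD o , e)) λ _ → _ , Outside-⊇ isC isB isA isD ox , xb , xd)
  ... | yes (_ , olc , lcc) | yes (_ , ola , laa) =
    ⊥-elim (¬outsideNbrs-a-c-bd s ola laa (λ lac → ¬adj-ac∧adj-bd s ola laa lac ox xb xd) olc lcc ox xb xd)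

  noChord : ∀ {a b c d} → Square a b c d → adj G a c ≡ false → adj G b d ≡ false → Conclusion
  noChord {a} {b} {c} {d} s ac≡ bd≡ with commonOutsideNbr? a b c d b d | commonOutsideNbr? a b c d a c
  ... | yes bdNbr | _ = noChordWithBDNbr s ac≡ bd≡ bdNbr
  ... | no _ | yes (_ , o , ua , uc) =
    noChordWithBDNbr (rotate s) bd≡ (trans (sym G c a) ac≡) (_ , Outside-⊇ isB isC isD isA o , uc , ua)
  ... | no ¬bd | no ¬ac =
    inj₂ (fourBeads s ac≡ bd≡ (λ o ua uc → ¬ac (_ , o , ua , uc)) (λ o ub ud → ¬bd (_ , o , ub , ud)))

  conclusion : ∀ {a b c d} → Square a b c d → Conclusion
  conclusion {a} {b} {c} {d} s with adj G a c in ac≡ | adj G b d in bd≡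
  ... | true  | true  = bothChords s (Equivalence.from T-≡ ac≡) (Equivalence.from T-≡ bd≡)
  ... | false | true  = oneChord s ac≡ (Equivalence.from T-≡ bd≡)
  ... | true  | false = oneChord (rotate s) bd≡ (subst T (sym G a c) (Equivalence.from T-≡ ac≡))
  ... | false | false = noChord s ac≡ bd≡

lemma4p4 : (G : Graph) → Connected G → ¬ HasYSubgraph G →
    (∃ λ k → 4 ≤ k × HasEDCycle G k) →
    HasEDCycle G 4 → (∀ k → HasEDCycle G k → k ≤ 4) →
    FromSmallByCloningLeaves 6 G ⊎ IsSpikedNecklace G
lemma4p4 G connected noY _ C₄ maximal =
  let (_ , _ , _ , _ , s) = square G connected noY maximal C₄ in conclusion G connected noY maximal s
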